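{- Let $m \ge 2$ and $g \ge 2$ be integers and let $F(x_1,\ldots,x_m) = x_1 + gx_2 + g^2x_3 + \cdots + g^{m-1}x_m$. Let \[ A = \left\{ \sum_{i=0}^{\infty} d_i g^{im} : d_i \in \{0,1,\ldots,g-1\} \text{ and } d_i = 0 \text{ for all sufficiently large } i \right\}, \] the set of nonnegative integers whose base-$g^m$ representations use only the digits $0,1,\ldots,g-1$. Then $A$ is a Sidon set with respect to $F$ (i.e. $R_{A,F}(n) \le 1$ for all integers $n$) and $A$ is a basis for $\mathbf{N}_0$ with respect to $F$ (i.e. $R_{A,F}(n) \ge 1$ for all $n \in \mathbf{N}_0$).
   Context: $\mathbf{N}_0$ denotes the set of nonnegative integers. For a set $A$ of integers, $R_{A,F}(n) = \operatorname{card}\{(a_1,\ldots,a_m) \in A^m : F(a_1,\ldots,a_m) = n\}$ for $n \in \mathbf{Z}$. -}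

module Defs where

open import Data.Nat using (ℕ; zero; suc; _+_; _*_; _^_; _<_)
open import Data.Fin using (Fin; toℕ)
open import Data.List using (List; []; _∷_)
open import Data.List.Relation.Unary.All using (All)
open import Data.Product using (Σ; _×_)
open import Relation.Binary.PropositionalEquality using (_≡_)

digitsValue : ℕ → List ℕ → ℕ
digitsValue b []       = 0
digitsValue b (d ∷ ds) = d + b * digitsValue b ds

InA : (m g : ℕ) → ℕ → Set
InA m g n = Σ (List ℕ) λ ds → All (λ d → d < g) ds × n ≡ digitsValue (g ^ m) ds

sumFin : (m : ℕ) → (Fin m → ℕ) → ℕ
sumFin zero    f = 0
sumFin (suc m) f = f Fin.zero + sumFin m (λ i → f (Fin.suc i))

F : (m g : ℕ) → (Fin m → ℕ) → ℕ
F m g x = sumFin m (λ i → g ^ toℕ i * x i)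

{-# OPTIONS --safe #-}
-- Write every element of A as d + G·x with G = g^m, a digit d < g and x ∈ A. Applying this to the
-- coordinates of a ∈ Aᵐ gives F(a) = F(d) + G·F(x), and since the base-g digits of F(d) are exactly
-- d₁, …, d_m, the map d ↦ F(d) is a bijection from {0,…,g-1}ᵐ onto {0,…,G-1}. Hence F(d) and F(x)
-- are the remainder and the quotient of F(a) by G, and strong induction on F(a) shows that F
-- restricted to Aᵐ is a bijection onto ℕ₀: the Sidon property is its injectivity and the basis
-- property its surjectivity.
module Submission where

open import Defs
open import Data.Nat
  using (ℕ; zero; suc; _+_; _*_; _^_; _≤_; _<_; s≤s; NonZero; >-nonZero; ≢-nonZero; ≢-nonZero⁻¹; _/_; _%_; z<s)
open import Data.Nat.Properties
open import Data.Nat.DivMod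
  using (m≡m%n+[m/n]*n; [m+kn]%n≡m%n; m<n⇒m%n≡m; +-distrib-/-∣ʳ; m<n⇒m/n≡0; m*n/n≡m; m%n<n; m/n<m; m<n*o⇒m/o<n)
open import Data.Nat.Divisibility using (divides-refl)
open import Data.Nat.Induction using (<-wellFounded)
open import Data.Fin using (Fin; toℕ)
open import Data.Vec.Functional using (head; tail) renaming (_∷_ to _◂_)
open import Data.List using ([]; _∷_)
open import Data.List.Relation.Unary.All using ([]; _∷_)
open import Data.Product using (Σ; _×_; _,_)
open import Induction.WellFounded using (Acc; acc)
open import Relation.Binary.PropositionalEquality
open import Relation.Nullary using (yes; no)
open import Algebra.Properties.CommutativeSemigroup +-commutativeSemigroup using (interchange)
open import Algebra.Properties.CommutativeSemigroup *-commutativeSemigroup using (x∙yz≈y∙xz)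

m≡m%n+n*[m/n] : ∀ m n .{{_ : NonZero n}} → m ≡ m % n + n * (m / n)
m≡m%n+n*[m/n] m n = trans (m≡m%n+[m/n]*n m n) (cong (m % n +_) (*-comm (m / n) n))

[r+n*q]%n≡r : ∀ {r n} q .{{_ : NonZero n}} → r < n → (r + n * q) % n ≡ r
[r+n*q]%n≡r {r} {n} q r<n = begin
  (r + n * q) % n ≡⟨ cong (λ x → (r + x) % n) (*-comm n q) ⟩
  (r + q * n) % n ≡⟨ [m+kn]%n≡m%n r q n ⟩
  r % n           ≡⟨ m<n⇒m%n≡m r<n ⟩
  r               ∎
  where open ≡-Reasoning

[r+n*q]/n≡q : ∀ {r n} q .{{_ : NonZero n}} → r < n → (r + n * q) / n ≡ q
[r+n*q]/n≡q {r} {n} q r<n = begin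
  (r + n * q) / n   ≡⟨ cong (λ x → (r + x) / n) (*-comm n q) ⟩
  (r + q * n) / n   ≡⟨ +-distrib-/-∣ʳ r (divides-refl q) ⟩
  r / n + q * n / n ≡⟨ cong₂ _+_ (m<n⇒m/n≡0 r<n) (m*n/n≡m q n) ⟩
  q                 ∎
  where open ≡-Reasoning

sumFin-cong : ∀ m {f h : Fin m → ℕ} → (∀ i → f i ≡ h i) → sumFin m f ≡ sumFin m h
sumFin-cong zero    f≗h = refl
sumFin-cong (suc m) f≗h = cong₂ _+_ (f≗h Fin.zero) (sumFin-cong m (λ i → f≗h (Fin.suc i)))

sumFin-+ : ∀ m (f h : Fin m → ℕ) → sumFin m (λ i → f i + h i) ≡ sumFin m f + sumFin m h
sumFin-+ zero    f h = refl
sumFin-+ (suc m) f h = begin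
  (head f + head h) + sumFin m (λ i → tail f i + tail h i)
    ≡⟨ cong ((head f + head h) +_) (sumFin-+ m (tail f) (tail h)) ⟩
  (head f + head h) + (sumFin m (tail f) + sumFin m (tail h))
    ≡⟨ interchange (head f) (head h) _ _ ⟩
  (head f + sumFin m (tail f)) + (head h + sumFin m (tail h))
    ∎
  where open ≡-Reasoning

sumFin-*ˡ : ∀ m c (f : Fin m → ℕ) → sumFin m (λ i → c * f i) ≡ c * sumFin m f
sumFin-*ˡ zero    c f = sym (*-zeroʳ c)
sumFin-*ˡ (suc m) c f =
  trans (cong (c * head f +_) (sumFin-*ˡ m c (tail f))) (sym (*-distribˡ-+ c (head f) _))

sumFin≡0⇒ : ∀ m (f : Fin m → ℕ) → sumFin m f ≡ 0 → ∀ i → f i ≡ 0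
sumFin≡0⇒ (suc m) f Σf≡0 Fin.zero    = m+n≡0⇒m≡0 (head f) Σf≡0
sumFin≡0⇒ (suc m) f Σf≡0 (Fin.suc i) = sumFin≡0⇒ m (tail f) (m+n≡0⇒n≡0 (head f) Σf≡0) i

F-cong : ∀ m g {a b : Fin m → ℕ} → (∀ i → a i ≡ b i) → F m g a ≡ F m g b
F-cong m g a≗b = sumFin-cong m (λ i → cong (g ^ toℕ i *_) (a≗b i))

F-suc : ∀ m g (d : Fin (suc m) → ℕ) → F (suc m) g d ≡ head d + g * F m g (tail d)
F-suc m g d = cong₂ _+_ (*-identityˡ (head d)) (begin
  sumFin m (λ i → g * g ^ toℕ i * tail d i)   ≡⟨ sumFin-cong m (λ i → *-assoc g _ _) ⟩
  sumFin m (λ i → g * (g ^ toℕ i * tail d i)) ≡⟨ sumFin-*ˡ m g _ ⟩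
  g * F m g (tail d)                          ∎)
  where open ≡-Reasoning

F-+-* : ∀ m g c (d a : Fin m → ℕ) → F m g (λ i → d i + c * a i) ≡ F m g d + c * F m g a
F-+-* m g c d a = begin
  sumFin m (λ i → g ^ toℕ i * (d i + c * a i))
    ≡⟨ sumFin-cong m (λ i → trans (*-distribˡ-+ (g ^ toℕ i) (d i) _)
                                  (cong (g ^ toℕ i * d i +_) (x∙yz≈y∙xz (g ^ toℕ i) c (a i)))) ⟩
  sumFin m (λ i → g ^ toℕ i * d i + c * (g ^ toℕ i * a i))
    ≡⟨ sumFin-+ m _ _ ⟩
  F m g d + sumFin m (λ i → c * (g ^ toℕ i * a i))
    ≡⟨ cong (F m g d +_) (sumFin-*ˡ m c _) ⟩
  F m g d + c * F m g a
    ∎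
  where open ≡-Reasoning

F-zero : ∀ m g → F m g (λ _ → 0) ≡ 0
F-zero m g = trans (sumFin-cong m (λ i → *-zeroʳ (g ^ toℕ i))) (sumFin-zero m)
  where
  sumFin-zero : ∀ k → sumFin k (λ _ → 0) ≡ 0
  sumFin-zero zero    = refl
  sumFin-zero (suc k) = sumFin-zero k

F≡0⇒ : ∀ m g .{{_ : NonZero g}} (a : Fin m → ℕ) → F m g a ≡ 0 → ∀ i → a i ≡ 0
F≡0⇒ m g a Fa≡0 i =
  m*n≡0⇒m≡0 (a i) (g ^ toℕ i) {{m^n≢0 g (toℕ i)}}
    (trans (*-comm (a i) (g ^ toℕ i)) (sumFin≡0⇒ m _ Fa≡0 i))

IsDigits : ℕ → ∀ {m} → (Fin m → ℕ) → Set
IsDigits g d = ∀ i → d i < g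

F-digits<g^m : ∀ m g (d : Fin m → ℕ) → IsDigits g d → F m g d < g ^ m
F-digits<g^m zero    g d d<g = z<s
F-digits<g^m (suc m) g d d<g = begin-strict
  F (suc m) g d               ≡⟨ F-suc m g d ⟩
  head d + g * F m g (tail d) <⟨ +-monoˡ-< _ (d<g Fin.zero) ⟩
  g + g * F m g (tail d)      ≡⟨ *-suc g _ ⟨
  g * suc (F m g (tail d))    ≤⟨ *-monoʳ-≤ g (F-digits<g^m m g (tail d) (λ i → d<g (Fin.suc i))) ⟩
  g * g ^ m                   ∎
  where open ≤-Reasoning

F-digits-injective : ∀ m g .{{_ : NonZero g}} (d e : Fin m → ℕ) → IsDigits g d → IsDigits g e →
                     F m g d ≡ F m g e → ∀ i → d i ≡ e i
F-digits-injective (suc m) g d e d<g e<g Fd≡Fe Fin.zero = begin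
  head d                            ≡⟨ [r+n*q]%n≡r _ (d<g Fin.zero) ⟨
  (head d + g * F m g (tail d)) % g ≡⟨ cong (_% g) (trans (sym (F-suc m g d)) (trans Fd≡Fe (F-suc m g e))) ⟩
  (head e + g * F m g (tail e)) % g ≡⟨ [r+n*q]%n≡r _ (e<g Fin.zero) ⟩
  head e                            ∎
  where open ≡-Reasoning
F-digits-injective (suc m) g d e d<g e<g Fd≡Fe (Fin.suc i) =
  F-digits-injective m g (tail d) (tail e) (λ j → d<g (Fin.suc j)) (λ j → e<g (Fin.suc j)) Ftail≡ i
  where
  open ≡-Reasoning
  Ftail≡ : F m g (tail d) ≡ F m g (tail e)
  Ftail≡ = begin
    F m g (tail d)                    ≡⟨ [r+n*q]/n≡q _ (d<g Fin.zero) ⟨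
    (head d + g * F m g (tail d)) / g ≡⟨ cong (_/ g) (trans (sym (F-suc m g d)) (trans Fd≡Fe (F-suc m g e))) ⟩
    (head e + g * F m g (tail e)) / g ≡⟨ [r+n*q]/n≡q _ (e<g Fin.zero) ⟩
    F m g (tail e)                    ∎

F-digits-surjective : ∀ m g .{{_ : NonZero g}} r → r < g ^ m →
                      Σ (Fin m → ℕ) λ d → IsDigits g d × F m g d ≡ r
F-digits-surjective zero g zero    _         = (λ ()) , (λ ()) , refl
F-digits-surjective zero g (suc r) (s≤s ())
F-digits-surjective (suc m) g r r<g*g^m
  with F-digits-surjective m g (r / g) (m<n*o⇒m/o<n (subst (r <_) (*-comm g (g ^ m)) r<g*g^m))
... | d , d<g , Fd≡r/g = (r % g ◂ d) , digits , (begin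
  F (suc m) g (r % g ◂ d)  ≡⟨ F-suc m g (r % g ◂ d) ⟩
  r % g + g * F m g d      ≡⟨ cong (λ x → r % g + g * x) Fd≡r/g ⟩
  r % g + g * (r / g)      ≡⟨ m≡m%n+n*[m/n] r g ⟨
  r                        ∎)
  where
  open ≡-Reasoning
  digits : IsDigits g (r % g ◂ d)
  digits Fin.zero    = m%n<n r g
  digits (Fin.suc i) = d<g i

InA-zero : ∀ m g → InA m g 0
InA-zero m g = [] , [] , refl

InA-cons : ∀ m g {d x} → d < g → InA m g x → InA m g (d + g ^ m * x)
InA-cons m g d<g (ds , ds<g , refl) = (_ ∷ ds) , (d<g ∷ ds<g) , refl

record Uncons (m g x : ℕ) : Set where
  field
    digit   : ℕ
    rest    : ℕ
    digit<g : digit < g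
    rest∈A  : InA m g rest
    x≡      : x ≡ digit + g ^ m * rest

uncons : ∀ m g .{{_ : NonZero g}} {x} → InA m g x → Uncons m g x
uncons m g ([]     , []         , refl) = record
  { digit = 0 ; rest = 0 ; digit<g = n≢0⇒n>0 (≢-nonZero⁻¹ g) ; rest∈A = InA-zero m g ; x≡ = sym (*-zeroʳ (g ^ m)) }
uncons m g (d ∷ ds , d<g ∷ ds<g , refl) = record
  { digit = d ; rest = _ ; digit<g = d<g ; rest∈A = ds , ds<g , refl ; x≡ = refl }

module _ (m g : ℕ) .{{_ : NonZero g}} {a : Fin m → ℕ} (a∈A : ∀ i → InA m g (a i)) where
  open Uncons

  low high : Fin m → ℕ
  low  i = digit (uncons m g (a∈A i))
  high i = rest (uncons m g (a∈A i))

  high∈A : ∀ i → InA m g (high i)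
  high∈A i = rest∈A (uncons m g (a∈A i))

  low<g : IsDigits g low
  low<g i = digit<g (uncons m g (a∈A i))

  a≡low+g^m*high : ∀ i → a i ≡ low i + g ^ m * high i
  a≡low+g^m*high i = x≡ (uncons m g (a∈A i))

  F≡F-low+g^m*F-high : F m g a ≡ F m g low + g ^ m * F m g high
  F≡F-low+g^m*F-high = trans (F-cong m g a≡low+g^m*high) (F-+-* m g (g ^ m) low high)

  private instance
    g^m≢0 : NonZero (g ^ m)
    g^m≢0 = m^n≢0 g m

  F%g^m≡F-low : F m g a % g ^ m ≡ F m g low
  F%g^m≡F-low = trans (cong (_% g ^ m) F≡F-low+g^m*F-high)
                      ([r+n*q]%n≡r (F m g high) (F-digits<g^m m g low low<g))

  F/g^m≡F-high : F m g a / g ^ m ≡ F m g high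
  F/g^m≡F-high = trans (cong (_/ g ^ m) F≡F-low+g^m*F-high)
                       ([r+n*q]/n≡q (F m g high) (F-digits<g^m m g low low<g))

module _ (m g : ℕ) .{{_ : NonZero g}} (1<g^m : 1 < g ^ m) where

  private instance
    g^m≢0 : NonZero (g ^ m)
    g^m≢0 = m^n≢0 g m

  F-injective-on-A : ∀ {a b} (a∈A : ∀ i → InA m g (a i)) (b∈A : ∀ i → InA m g (b i)) →
                     Acc _<_ (F m g a) → F m g a ≡ F m g b → ∀ i → a i ≡ b i
  F-injective-on-A {a} {b} a∈A b∈A (acc rs) Fa≡Fb with F m g a ≟ 0
  ... | yes Fa≡0 = λ i → trans (F≡0⇒ m g a Fa≡0 i) (sym (F≡0⇒ m g b (trans (sym Fa≡Fb) Fa≡0) i))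
  ... | no  Fa≢0 = λ i → begin
    a i                                    ≡⟨ a≡low+g^m*high m g a∈A i ⟩
    low m g a∈A i + g ^ m * high m g a∈A i ≡⟨ cong₂ (λ x y → x + g ^ m * y) (low≡ i) (high≡ i) ⟩
    low m g b∈A i + g ^ m * high m g b∈A i ≡⟨ a≡low+g^m*high m g b∈A i ⟨
    b i                                    ∎
    where
    open ≡-Reasoning
    low≡ : ∀ i → low m g a∈A i ≡ low m g b∈A i
    low≡ = F-digits-injective m g _ _ (low<g m g a∈A) (low<g m g b∈A)
      (trans (sym (F%g^m≡F-low m g a∈A)) (trans (cong (_% g ^ m) Fa≡Fb) (F%g^m≡F-low m g b∈A)))
    F-high<F : F m g (high m g a∈A) < F m g a
    F-high<F = subst (_< F m g a) (F/g^m≡F-high m g a∈A) (m/n<m (F m g a) (g ^ m) {{≢-nonZero Fa≢0}} 1<g^m)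
    high≡ : ∀ i → high m g a∈A i ≡ high m g b∈A i
    high≡ = F-injective-on-A (high∈A m g a∈A) (high∈A m g b∈A) (rs F-high<F)
      (trans (sym (F/g^m≡F-high m g a∈A)) (trans (cong (_/ g ^ m) Fa≡Fb) (F/g^m≡F-high m g b∈A)))

  F-surjective-on-A : ∀ {n} → Acc _<_ n → Σ (Fin m → ℕ) λ a → (∀ i → InA m g (a i)) × F m g a ≡ n
  F-surjective-on-A {zero} _ = (λ _ → 0) , (λ _ → InA-zero m g) , F-zero m g
  F-surjective-on-A {n@(suc _)} (acc rs)
    with F-surjective-on-A (rs (m/n<m n (g ^ m) 1<g^m)) | F-digits-surjective m g (n % g ^ m) (m%n<n n (g ^ m))
  ... | high , high∈A , F-high≡ | low , low<g , F-low≡ =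
    (λ i → low i + g ^ m * high i) , (λ i → InA-cons m g (low<g i) (high∈A i)) , (begin
      F m g (λ i → low i + g ^ m * high i) ≡⟨ F-+-* m g (g ^ m) low high ⟩
      F m g low + g ^ m * F m g high       ≡⟨ cong₂ (λ x y → x + g ^ m * y) F-low≡ F-high≡ ⟩
      n % g ^ m + g ^ m * (n / g ^ m)      ≡⟨ m≡m%n+n*[m/n] n (g ^ m) ⟨
      n                                    ∎)
    where open ≡-Reasoning

mainTheorem3 : (m g : ℕ) → 2 ≤ m → 2 ≤ g →
    ((a b : Fin m → ℕ) → (∀ i → InA m g (a i)) → (∀ i → InA m g (b i)) →
      F m g a ≡ F m g b → ∀ i → a i ≡ b i)
    × ((n : ℕ) → Σ (Fin m → ℕ) λ a → (∀ i → InA m g (a i)) × F m g a ≡ n)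
mainTheorem3 m g 2≤m 2≤g =
  (λ a b a∈A b∈A → F-injective-on-A m g 1<g^m a∈A b∈A (<-wellFounded (F m g a))) ,
  (λ n → F-surjective-on-A m g 1<g^m (<-wellFounded n))
  where
  instance
    g≢0 : NonZero g
    g≢0 = >-nonZero (<-trans z<s 2≤g)
  1<g^m : 1 < g ^ m
  1<g^m = ^-monoʳ-< g 2≤g (<-trans z<s 2≤m)
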